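{- Let $k\in\mathbb{N}_0$. Every graph $G$ with treewidth at most $k$ is contained in $H_1\boxtimes H_2$ for some graphs $H_1$ and $H_2$ with $\mathrm{tw}(H_i)\leq\lceil(k+1)/2\rceil$ for each $i\in\{1,2\}$.
   Context: Graphs are finite and simple; $\mathrm{tw}$ is treewidth. The strong product $A\boxtimes B$ has vertex set $V(A)\times V(B)$, distinct $(v,x),(w,y)$ adjacent iff ($v=w$ or $vw\in E(A)$) and ($x=y$ or $xy\in E(B)$). $G$ is contained in $H$ if $G$ is isomorphic to a subgraph of $H$. -}

module Defs where

open import Data.Nat using (ℕ; suc; _*_; _≤_)
open import Data.Fin using (Fin; remQuot; _≟_)
open import Data.Fin.Subset using (Subset; _∈_; ∣_∣)
open import Data.Bool using (Bool; true; false; _∧_; _∨_; not)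
open import Data.Product using (Σ; _×_; _,_; proj₁; proj₂)
open import Data.Unit using (⊤)
open import Data.List using (List; length; _++_; take)
open import Data.List.Relation.Unary.Unique.Propositional using (Unique)
open import Data.List.Relation.Unary.Linked using (Linked)
open import Relation.Nullary using (¬_; yes; no)
open import Relation.Nullary.Decidable using (⌊_⌋)
open import Relation.Binary.PropositionalEquality using (_≡_; refl; sym; cong₂)
open import Function.Definitions using (Injective)

record Graph : Set where
  field
    n     : ℕ
    adj   : Fin n → Fin n → Bool
    symm  : ∀ u v → adj u v ≡ adj v u
    irref : ∀ v → adj v v ≡ false
open Graph public

Vtx : Graph → Set
Vtx G = Fin (n G)

Adj : (G : Graph) → Vtx G → Vtx G → Set
Adj G u v = adj G u v ≡ true

data Walk (G : Graph) (P : Vtx G → Set) : Vtx G → Vtx G → Set where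
  here : ∀ {x} → P x → Walk G P x x
  step : ∀ {x y z} → P x → Adj G x y → Walk G P y z → Walk G P x z

Connected : Graph → Set
Connected G = ∀ x y → Walk G (λ _ → ⊤) x y

HasCycle : Graph → Set
HasCycle G = Σ (List (Vtx G)) λ vs →
  (3 ≤ length vs) × Unique vs × Linked (Adj G) (vs ++ take 1 vs)

IsTree : Graph → Set
IsTree T = Connected T × ¬ HasCycle T

record TreeDecomposition (G : Graph) : Set where
  field
    T        : Graph
    isTree   : IsTree T
    bag      : Vtx T → Subset (n G)
    covV     : ∀ v → Σ (Vtx T) λ t → v ∈ bag t
    covE     : ∀ u v → Adj G u v → Σ (Vtx T) λ t → (u ∈ bag t) × (v ∈ bag t)
    subtree  : ∀ v x y → v ∈ bag x → v ∈ bag y → Walk T (λ t → v ∈ bag t) x y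
open TreeDecomposition public

TwAtMost : Graph → ℕ → Set
TwAtMost G k = Σ (TreeDecomposition G) λ D → ∀ t → ∣ bag D t ∣ ≤ suc k

_⊆G_ : Graph → Graph → Set
G ⊆G H = Σ (Vtx G → Vtx H) λ f → Injective _≡_ _≡_ f × (∀ u v → Adj G u v → Adj H (f u) (f v))

-- strong product; vertex set Fin (n A * n B) ≅ Fin (n A) × Fin (n B) via remQuot
eqb : ∀ {m} → Fin m → Fin m → Bool
eqb i j = ⌊ i ≟ j ⌋

eqb-sym : ∀ {m} (i j : Fin m) → eqb i j ≡ eqb j i
eqb-sym i j with i ≟ j | j ≟ i
... | yes _ | yes _ = refl
... | no _  | no _  = refl
... | yes p | no q  with q (sym p)
...   | ()
eqb-sym i j | no q | yes p with q (sym p)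
...   | ()

eqb-refl : ∀ {m} (i : Fin m) → eqb i i ≡ true
eqb-refl i with i ≟ i
... | yes _ = refl
... | no q with q refl
...   | ()

_⊠_ : Graph → Graph → Graph
A ⊠ B = record { n = n A * n B ; adj = ad ; symm = sy ; irref = ir }
  where
  c : Fin (n A * n B) → Fin (n A) × Fin (n B)
  c = remQuot (n B)
  ad : Fin (n A * n B) → Fin (n A * n B) → Bool
  ad p q = not (eqb p q)
         ∧ (eqb (proj₁ (c p)) (proj₁ (c q)) ∨ adj A (proj₁ (c p)) (proj₁ (c q)))
         ∧ (eqb (proj₂ (c p)) (proj₂ (c q)) ∨ adj B (proj₂ (c p)) (proj₂ (c q)))
  sy : ∀ p q → ad p q ≡ ad q p
  sy p q rewrite eqb-sym p q
               | eqb-sym (proj₁ (c p)) (proj₁ (c q)) | Graph.symm A (proj₁ (c p)) (proj₁ (c q))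
               | eqb-sym (proj₂ (c p)) (proj₂ (c q)) | Graph.symm B (proj₂ (c p)) (proj₂ (c q)) = refl
  ir : ∀ p → ad p p ≡ false
  ir p rewrite eqb-refl p = refl

{-# OPTIONS --safe #-}
-- Take a tree decomposition with bags of size at most k + 1 ≤ 2m, m = ⌈(k+1)/2⌉, and colour the
-- vertices so that every bag has at most m vertices of each colour. With S one colour class,
-- v ↦ (v or apex, v or apex) embeds G into cone(G[S]) ⊠ cone(G[∁S]), and each cone has width at
-- most m, with bags (B ∩ S) ∪ {apex} on the same tree.
-- The colouring is built leaf by leaf: a convex set R of tree nodes has a leaf ℓ (the end of a
-- maximal path in R). Colour R - ℓ first. By convexity, the vertices of bag ℓ coloured so far all
-- lie in the bag of ℓ's neighbour, so they are balanced; as ∣ bag ℓ ∣ ≤ 2m, the new vertices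
-- can fill up both colours to at most m.
module Submission where

open import Defs
open import Data.Bool using (Bool; true; false; not; _∧_; _∨_)
import Data.Bool.Properties as Bool
open import Data.Fin using (Fin; zero; suc; _≟_; toℕ; combine)
open import Data.Fin.Properties
  using (any?; suc-injective; injective⇒≤; remQuot-combine; combine-injectiveˡ; combine-injectiveʳ)
open import Data.Fin.Subset
  using (Subset; inside; outside; _∈_; _∉_; _⊆_; _∩_; ∁; _─_; _-_; ⊥; ⊤; ∣_∣)
open import Data.Fin.Subset.Properties
  using (_∈?_; nonempty?; drop-there; drop-∷-⊆; x∉p⇒x∈∁p; x∈p∩q⁺; x∈p∩q⁻; ∈⊤; ∣⊥∣≡0;
         p⊆q⇒∣p∣≤∣q∣; p─q⊆p; x∈p∧x≢y⇒x∈p-y; x∈⁅x⁆; x∈p⇒∣p-x∣<∣p∣)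
open import Data.List using (List; []; _∷_; _++_; length; take; lookup)
open import Data.List.Membership.Propositional.Properties using (∈-lookup)
import Data.List.Membership.Propositional as List
open import Data.List.Relation.Unary.All as All using (All; []; _∷_)
open import Data.List.Relation.Unary.All.Properties using (¬Any⇒All¬)
open import Data.List.Relation.Unary.Any using (index) renaming (here to hereₗ; there to thereₗ)
open import Data.List.Relation.Unary.AllPairs using ([]; _∷_)
open import Data.List.Relation.Unary.Linked using (Linked; []; [-]; _∷_)
open import Data.List.Relation.Unary.Unique.Propositional using (Unique)
import Data.List.Relation.Unary.Unique.Propositional.Properties as Unique
open import Data.Nat using (ℕ; zero; suc; _+_; _*_; _∸_; _≤_; _<_; z≤n; s≤s; ⌈_/2⌉)
open import Data.Nat.Induction using (<-wellFounded)
open import Data.Nat.Properties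
  using (≤-refl; ≤-reflexive; ≤-trans; <⇒≱; +-suc; +-identityʳ;
         +-monoˡ-≤; +-monoʳ-≤; +-cancelˡ-≤; +-cancelˡ-≡; m+[n∸m]≡n; m≤n+o⇒m∸n≤o;
         ⌊n/2⌋≤⌈n/2⌉; ⌊n/2⌋+⌈n/2⌉≡n; +-commutativeSemigroup; module ≤-Reasoning)
open import Algebra.Properties.CommutativeSemigroup +-commutativeSemigroup using (interchange)
open import Data.Product using (Σ; ∃; ∃₂; _×_; _,_; proj₁; proj₂)
open import Data.Sum using (_⊎_; inj₁; inj₂)
open import Data.Vec using ([]; _∷_; here; there)
open import Function using (_∘_)
open import Function.Definitions using (Injective)
open import Induction.WellFounded using (Acc; acc)
open import Relation.Nullary using (¬_; Dec; yes; no; contradiction; ¬?; _×-dec_)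
open import Relation.Binary.PropositionalEquality
  using (_≡_; _≢_; refl; sym; trans; cong; cong₂; subst; subst₂; module ≡-Reasoning)

private variable
  N : ℕ

∣p∩q∣+∣p∩∁q∣≡∣p∣ : (p q : Subset N) → ∣ p ∩ q ∣ + ∣ p ∩ ∁ q ∣ ≡ ∣ p ∣
∣p∩q∣+∣p∩∁q∣≡∣p∣ []            []            = refl
∣p∩q∣+∣p∩∁q∣≡∣p∣ (outside ∷ p) (_ ∷ q)       = ∣p∩q∣+∣p∩∁q∣≡∣p∣ p q
∣p∩q∣+∣p∩∁q∣≡∣p∣ (inside ∷ p)  (inside ∷ q)  = cong suc (∣p∩q∣+∣p∩∁q∣≡∣p∣ p q)
∣p∩q∣+∣p∩∁q∣≡∣p∣ (inside ∷ p)  (outside ∷ q) =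
  trans (+-suc ∣ p ∩ q ∣ _) (cong suc (∣p∩q∣+∣p∩∁q∣≡∣p∣ p q))

x∈p-y⇒x≢y : {x y : Fin N} {p : Subset N} → x ∈ p - y → x ≢ y
x∈p-y⇒x≢y {y = y} {p} x∈p-y refl = x∈q⇒x∉p─q (x∈⁅x⁆ y) p x∈p-y
  where
  x∈q⇒x∉p─q : ∀ {N} {x : Fin N} {q} → x ∈ q → (p : Subset N) → x ∉ p ─ q
  x∈q⇒x∉p─q here        (inside  ∷ p) ()
  x∈q⇒x∉p─q here        (outside ∷ p) ()
  x∈q⇒x∉p─q (there x∈q) (_ ∷ p)       (there x∈p─q) = x∈q⇒x∉p─q x∈q p x∈p─q

-- element q enumerates q in increasing order; restrict q p is p ∩ q, indexed by the elements of q.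

element : (q : Subset N) → Fin ∣ q ∣ → Fin N
element (inside  ∷ q) zero    = zero
element (inside  ∷ q) (suc i) = suc (element q i)
element (outside ∷ q) i       = suc (element q i)

position : (q : Subset N) {x : Fin N} → x ∈ q → Fin ∣ q ∣
position (inside  ∷ q) here        = zero
position (inside  ∷ q) (there x∈q) = suc (position q x∈q)
position (outside ∷ q) (there x∈q) = position q x∈q

element-position : (q : Subset N) {x : Fin N} (x∈q : x ∈ q) → element q (position q x∈q) ≡ x
element-position (inside  ∷ q) here        = refl
element-position (inside  ∷ q) (there x∈q) = cong suc (element-position q x∈q)
element-position (outside ∷ q) (there x∈q) = cong suc (element-position q x∈q)

restrict : (q : Subset N) → Subset N → Subset ∣ q ∣
restrict []            []      = []
restrict (inside  ∷ q) (b ∷ p) = b ∷ restrict q p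
restrict (outside ∷ q) (_ ∷ p) = restrict q p

∣restrict∣ : (q p : Subset N) → ∣ restrict q p ∣ ≡ ∣ p ∩ q ∣
∣restrict∣ []            []            = refl
∣restrict∣ (inside  ∷ q) (inside  ∷ p) = cong suc (∣restrict∣ q p)
∣restrict∣ (inside  ∷ q) (outside ∷ p) = ∣restrict∣ q p
∣restrict∣ (outside ∷ q) (inside  ∷ p) = ∣restrict∣ q p
∣restrict∣ (outside ∷ q) (outside ∷ p) = ∣restrict∣ q p

∈-restrict⁺ : (q : Subset N) {p : Subset N} {i : Fin ∣ q ∣} → element q i ∈ p → i ∈ restrict q p
∈-restrict⁺ (inside  ∷ q) {_ ∷ p} {zero}  here         = here
∈-restrict⁺ (inside  ∷ q) {_ ∷ p} {suc i} (there x∈p)  = there (∈-restrict⁺ q x∈p)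
∈-restrict⁺ (outside ∷ q) {_ ∷ p}         (there x∈p)  = ∈-restrict⁺ q x∈p

∈-restrict⁻ : (q : Subset N) {p : Subset N} {i : Fin ∣ q ∣} → i ∈ restrict q p → element q i ∈ p
∈-restrict⁻ (inside  ∷ q) {_ ∷ p} {zero}  here        = here
∈-restrict⁻ (inside  ∷ q) {_ ∷ p} {suc i} (there i∈r) = there (∈-restrict⁻ q i∈r)
∈-restrict⁻ (outside ∷ q) {_ ∷ p}         i∈r         = there (∈-restrict⁻ q i∈r)

Adj-sym : (G : Graph) {x y : Vtx G} → Adj G x y → Adj G y x
Adj-sym G {x} {y} x~y = trans (symm G y x) x~y

Adj-irrefl : (G : Graph) {x y : Vtx G} → Adj G x y → x ≢ y
Adj-irrefl G {x} x~x refl with trans (sym x~x) (irref G x)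
... | ()

Walk-map : {G : Graph} {P Q : Vtx G → Set} → (∀ {x} → P x → Q x) → ∀ {x y} → Walk G P x y → Walk G Q x y
Walk-map f (here p)       = here (f p)
Walk-map f (step p x~y w) = step (f p) x~y (Walk-map f w)

Walk-start : {G : Graph} {P : Vtx G → Set} {x y : Vtx G} → Walk G P x y → P x
Walk-start (here p)     = p
Walk-start (step p _ _) = p

_[_] : (G : Graph) → Subset (n G) → Graph
G [ S ] = record
  { n     = ∣ S ∣
  ; adj   = λ i j → adj G (element S i) (element S j)
  ; symm  = λ i j → symm G (element S i) (element S j)
  ; irref = λ i → irref G (element S i)
  }

cone : Graph → Graph
cone G = record { n = suc (n G) ; adj = adjᶜ ; symm = symmᶜ ; irref = irrefᶜ }
  where
  adjᶜ : Fin (suc (n G)) → Fin (suc (n G)) → Bool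
  adjᶜ zero    zero    = false
  adjᶜ zero    (suc _) = true
  adjᶜ (suc _) zero    = true
  adjᶜ (suc u) (suc v) = adj G u v
  symmᶜ : ∀ u v → adjᶜ u v ≡ adjᶜ v u
  symmᶜ zero    zero    = refl
  symmᶜ zero    (suc _) = refl
  symmᶜ (suc _) zero    = refl
  symmᶜ (suc u) (suc v) = symm G u v
  irrefᶜ : ∀ v → adjᶜ v v ≡ false
  irrefᶜ zero    = refl
  irrefᶜ (suc v) = irref G v

module _ {G : Graph} (D : TreeDecomposition G) where

  induced-decomposition : (S : Subset (n G)) → TreeDecomposition (G [ S ])
  induced-decomposition S = record
    { T       = T D
    ; isTree  = isTree D
    ; bag     = restrict S ∘ bag D
    ; covV    = λ i → let t , i∈t = covV D (element S i) in t , ∈-restrict⁺ S i∈t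
    ; covE    = λ i j i~j → let t , i∈t , j∈t = covE D _ _ i~j in
                            t , ∈-restrict⁺ S i∈t , ∈-restrict⁺ S j∈t
    ; subtree = λ i x y i∈x i∈y → Walk-map (∈-restrict⁺ S)
                  (subtree D (element S i) x y (∈-restrict⁻ S i∈x) (∈-restrict⁻ S i∈y))
    }

  -- the apex needs a node of the tree to live in
  cone-decomposition : Vtx (T D) → TreeDecomposition (cone G)
  cone-decomposition t₀ = record
    { T       = T D
    ; isTree  = isTree D
    ; bag     = λ t → inside ∷ bag D t
    ; covV    = covVᶜ
    ; covE    = covEᶜ
    ; subtree = subtreeᶜ
    }
    where
    covVᶜ : ∀ v → Σ (Vtx (T D)) λ t → v ∈ inside ∷ bag D t
    covVᶜ zero    = t₀ , here
    covVᶜ (suc v) = let t , v∈t = covV D v in t , there v∈t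
    covEᶜ : ∀ u v → Adj (cone G) u v →
      Σ (Vtx (T D)) λ t → (u ∈ inside ∷ bag D t) × (v ∈ inside ∷ bag D t)
    covEᶜ zero    (suc v) _   = let t , v∈t = covV D v in t , here , there v∈t
    covEᶜ (suc u) zero    _   = let t , u∈t = covV D u in t , there u∈t , here
    covEᶜ (suc u) (suc v) u~v = let t , u∈t , v∈t = covE D u v u~v in t , there u∈t , there v∈t
    subtreeᶜ : ∀ v x y → v ∈ inside ∷ bag D x → v ∈ inside ∷ bag D y →
      Walk (T D) (λ t → v ∈ inside ∷ bag D t) x y
    subtreeᶜ zero    x y _ _ = Walk-map (λ _ → here) (proj₁ (isTree D) x y)
    subtreeᶜ (suc v) x y v∈x v∈y = Walk-map there (subtree D v x y (drop-there v∈x) (drop-there v∈y))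

tw-cone-induced : {G : Graph} (D : TreeDecomposition G) → Vtx (T D) → {m : ℕ} (S : Subset (n G)) →
  (∀ t → ∣ bag D t ∩ S ∣ ≤ m) → TwAtMost (cone (G [ S ])) m
tw-cone-induced D t₀ S small =
  cone-decomposition (induced-decomposition D S) t₀ ,
  λ t → s≤s (≤-trans (≤-reflexive (∣restrict∣ S (bag D t))) (small t))

eqb-≢ : {i j : Fin N} → i ≢ j → eqb i j ≡ false
eqb-≢ {i = i} {j} i≢j with i ≟ j
... | yes i≡j = contradiction i≡j i≢j
... | no _    = refl

eqb∨adj : (A : Graph) {a a′ : Vtx A} → a ≡ a′ ⊎ Adj A a a′ → (eqb a a′ ∨ adj A a a′) ≡ true
eqb∨adj A {a}      (inj₁ refl)  rewrite eqb-refl a = refl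
eqb∨adj A {a} {a′} (inj₂ a~a′) rewrite a~a′       = Bool.∨-zeroʳ (eqb a a′)

⊠-adj : (A B : Graph) {a a′ : Vtx A} {b b′ : Vtx B} →
  a ≡ a′ ⊎ Adj A a a′ → b ≡ b′ ⊎ Adj B b b′ → combine a b ≢ combine a′ b′ →
  Adj (A ⊠ B) (combine a b) (combine a′ b′)
⊠-adj A B {a} {a′} {b} {b′} a≃a′ b≃b′ ab≢a′b′ =
  subst₂ (λ x x′ → not (eqb (combine a b) (combine a′ b′)) ∧ near x x′ ≡ true)
         (sym (remQuot-combine a b)) (sym (remQuot-combine a′ b′)) adjacent
  where
  near : Fin (n A) × Fin (n B) → Fin (n A) × Fin (n B) → Bool
  near x x′ = (eqb (proj₁ x) (proj₁ x′) ∨ adj A (proj₁ x) (proj₁ x′))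
            ∧ (eqb (proj₂ x) (proj₂ x′) ∨ adj B (proj₂ x) (proj₂ x′))
  adjacent : not (eqb (combine a b) (combine a′ b′)) ∧ near (a , b) (a′ , b′) ≡ true
  adjacent rewrite eqb-≢ ab≢a′b′ | eqb∨adj A a≃a′ | eqb∨adj B b≃b′ = refl

∈-or-∈∁ : (S : Subset N) (x : Fin N) → x ∈ S ⊎ x ∈ ∁ S
∈-or-∈∁ S x with x ∈? S
... | yes x∈S = inj₁ x∈S
... | no  x∉S = inj₂ (x∉p⇒x∈∁p x∉S)

module _ (G : Graph) (S : Subset (n G)) where

  into-cone : Vtx G → Vtx (cone (G [ S ]))
  into-cone v with v ∈? S
  ... | yes v∈S = suc (position S v∈S)
  ... | no  _   = zero

  into-cone-adj : {u v : Vtx G} → Adj G u v →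
    into-cone u ≡ into-cone v ⊎ Adj (cone (G [ S ])) (into-cone u) (into-cone v)
  into-cone-adj {u} {v} u~v with u ∈? S | v ∈? S
  ... | yes u∈S | yes v∈S =
    inj₂ (subst₂ (Adj G) (sym (element-position S u∈S)) (sym (element-position S v∈S)) u~v)
  ... | yes _   | no  _   = inj₂ refl
  ... | no  _   | yes _   = inj₂ refl
  ... | no  _   | no  _   = inj₁ refl

  into-cone-injective : {u v : Vtx G} → u ∈ S → into-cone u ≡ into-cone v → u ≡ v
  into-cone-injective {u} {v} u∈S eq with u ∈? S | v ∈? S
  ... | no  u∉S  | _       = contradiction u∈S u∉S
  ... | yes u∈S′ | yes v∈S = begin
    u                                ≡⟨ element-position S u∈S′ ⟨
    element S (position S u∈S′)      ≡⟨ cong (element S) (suc-injective eq) ⟩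
    element S (position S v∈S)       ≡⟨ element-position S v∈S ⟩
    v                                ∎
    where open ≡-Reasoning
  ... | yes _    | no  _   with eq
  ...   | ()

⊆G-cone⊠cone : (G : Graph) (S : Subset (n G)) → G ⊆G (cone (G [ S ]) ⊠ cone (G [ ∁ S ]))
⊆G-cone⊠cone G S = f , f-injective , f-adj
  where
  f : Vtx G → Fin (suc ∣ S ∣ * suc ∣ ∁ S ∣)
  f v = combine (into-cone G S v) (into-cone G (∁ S) v)
  f-injective : Injective _≡_ _≡_ f
  f-injective {u} {v} eq with ∈-or-∈∁ S u
  ... | inj₁ u∈S  = into-cone-injective G S u∈S
                      (combine-injectiveˡ _ (into-cone G (∁ S) u) _ (into-cone G (∁ S) v) eq)
  ... | inj₂ u∈∁S = into-cone-injective G (∁ S) u∈∁S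
                      (combine-injectiveʳ (into-cone G S u) _ (into-cone G S v) _ eq)
  f-adj : ∀ u v → Adj G u v → Adj (cone (G [ S ]) ⊠ cone (G [ ∁ S ])) (f u) (f v)
  f-adj u v u~v = ⊠-adj (cone (G [ S ])) (cone (G [ ∁ S ]))
                    (into-cone-adj G S u~v) (into-cone-adj G (∁ S) u~v) (Adj-irrefl G u~v ∘ f-injective)

-- Leaves of convex sets of tree nodes

module _ (T : Graph) where

  IsLeafOf : Subset (n T) → Vtx T → Set
  IsLeafOf R ℓ = ∀ {y z} → y ∈ R → z ∈ R → Adj T ℓ y → Adj T ℓ z → y ≡ z

  Convex : Subset (n T) → Set₁
  Convex R = ∀ {P : Vtx T → Set} {x y} → x ∈ R → y ∈ R → Walk T P x y → Walk T (λ t → P t × t ∈ R) x y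

  ⊤-convex : Convex ⊤
  ⊤-convex _ _ = Walk-map (_, ∈⊤)

  module _ {R : Subset (n T)} {ℓ : Vtx T} (leaf : IsLeafOf R ℓ) where

    -- a walk entering the leaf ℓ must leave it towards the node it came from
    avoid-leaf : ∀ {P : Vtx T → Set} {x y} → x ∈ R - ℓ → y ∈ R - ℓ →
      Walk T (λ t → P t × t ∈ R) x y → Walk T (λ t → P t × t ∈ R - ℓ) x y
    avoid-leaf x∈R′ y∈R′ (here (p , _)) = here (p , x∈R′)
    avoid-leaf x∈R′ y∈R′ (step {y = x₁} (p , _) x~x₁ w) with x₁ ≟ ℓ
    ... | no x₁≢ℓ =
      step (p , x∈R′) x~x₁ (avoid-leaf (x∈p∧x≢y⇒x∈p-y (proj₂ (Walk-start w)) x₁≢ℓ) y∈R′ w)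
    ... | yes refl with w
    ...   | here _ = contradiction refl (x∈p-y⇒x≢y y∈R′)
    ...   | step _ ℓ~x₂ w′ with leaf (proj₂ (Walk-start w′)) (p─q⊆p _ _ x∈R′) ℓ~x₂ (Adj-sym T x~x₁)
    ...     | refl = avoid-leaf x∈R′ y∈R′ w′

    Convex-remove-leaf : Convex R → Convex (R - ℓ)
    Convex-remove-leaf convex x∈R′ y∈R′ w =
      avoid-leaf x∈R′ y∈R′ (convex (p─q⊆p _ _ x∈R′) (p─q⊆p _ _ y∈R′) w)

  neighbour-on-walk : ∀ {R : Subset (n T)} {P : Vtx T → Set} {x y} →
    Convex R → x ∈ R → y ∈ R → x ≢ y → Walk T P x y → Σ (Vtx T) λ z → z ∈ R × Adj T x z × P z
  neighbour-on-walk convex x∈R y∈R x≢y w with convex x∈R y∈R w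
  ... | here _          = contradiction refl x≢y
  ... | step _ x~z w′   = _ , proj₂ (Walk-start w′) , x~z , proj₁ (Walk-start w′)

Unique⇒lookup-injective : {A : Set} {xs : List A} → Unique xs → Injective _≡_ _≡_ (lookup xs)
Unique⇒lookup-injective (_ ∷ _)      {zero}  {zero}  _  = refl
Unique⇒lookup-injective (x∉xs ∷ _)   {zero}  {suc j} eq = contradiction eq (All.lookup x∉xs (∈-lookup j))
Unique⇒lookup-injective (x∉xs ∷ _)   {suc i} {zero}  eq =
  contradiction (sym eq) (All.lookup x∉xs (∈-lookup i))
Unique⇒lookup-injective (_ ∷ unique) {suc i} {suc j} eq = cong suc (Unique⇒lookup-injective unique eq)

Unique⇒length≤ : {xs : List (Fin N)} → Unique xs → length xs ≤ N
Unique⇒length≤ unique = injective⇒≤ (Unique⇒lookup-injective unique)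

prefixThrough : {A : Set} {w : A} (xs : List A) → w List.∈ xs → List A
prefixThrough xs w∈xs = take (suc (toℕ (index w∈xs))) xs

prefixThrough-Linked : {A : Set} {R : A → A → Set} {w a : A} {xs : List A} (w∈xs : w List.∈ xs) →
  Linked R xs → R w a → Linked R (prefixThrough xs w∈xs ++ a ∷ [])
prefixThrough-Linked {xs = _ ∷ _}     (hereₗ refl)    _              w~a = w~a ∷ [-]
prefixThrough-Linked {xs = _ ∷ []}    (thereₗ ())
prefixThrough-Linked {xs = _ ∷ _ ∷ _} (thereₗ w∈xs)   (x~y ∷ linked) w~a =
  x~y ∷ prefixThrough-Linked w∈xs linked w~a

module _ (T : Graph) (acyclic : ¬ HasCycle T) (R : Subset (n T)) where

  TwoNeighboursIn : Vtx T → Set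
  TwoNeighboursIn x = ∃₂ λ y z → y ∈ R × z ∈ R × Adj T x y × Adj T x z × y ≢ z

  twoNeighboursIn? : ∀ x → Dec (TwoNeighboursIn x)
  twoNeighboursIn? x = any? λ y → any? λ z →
    y ∈? R ×-dec z ∈? R ×-dec adj T x y Bool.≟ true ×-dec adj T x z Bool.≟ true ×-dec ¬? (y ≟ z)

  ¬TwoNeighboursIn⇒IsLeafOf : ∀ {x} → ¬ TwoNeighboursIn x → IsLeafOf T R x
  ¬TwoNeighboursIn⇒IsLeafOf ¬two {y} {z} y∈R z∈R x~y x~z with y ≟ z
  ... | yes y≡z = y≡z
  ... | no  y≢z = contradiction (y , z , y∈R , z∈R , x~y , x~z , y≢z) ¬two

  -- Paths are kept newest vertex first, so take 1 rest is the previous vertex.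
  next-neighbour : ∀ {x} → TwoNeighboursIn x → (rest : List (Vtx T)) →
    ∃ λ w → w ∈ R × Adj T x w × All (w ≢_) (take 1 rest)
  next-neighbour (y , z , y∈R , z∈R , x~y , x~z , y≢z) []        = y , y∈R , x~y , []
  next-neighbour (y , z , y∈R , z∈R , x~y , x~z , y≢z) (x′ ∷ _) with y ≟ x′
  ... | yes refl = z , z∈R , x~z , (y≢z ∘ sym) ∷ []
  ... | no  y≢x′ = y , y∈R , x~y , y≢x′ ∷ []

  no-chord : ∀ {x w rest} → Unique (x ∷ rest) → Linked (Adj T) (x ∷ rest) → Adj T x w →
    All (w ≢_) (take 1 rest) → ¬ (w List.∈ x ∷ rest)
  no-chord _ _ x~w _ (hereₗ refl) = Adj-irrefl T x~w refl
  no-chord {rest = _ ∷ _} _ _ _ (w≢x′ ∷ []) (thereₗ (hereₗ w≡x′)) = w≢x′ w≡x′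
  no-chord {rest = _ ∷ _ ∷ _} unique linked x~w _ (thereₗ (thereₗ w∈rest)) =
    acyclic (prefixThrough _ (thereₗ (thereₗ w∈rest)) , s≤s (s≤s (s≤s z≤n)) , Unique.take⁺ _ unique ,
             prefixThrough-Linked (thereₗ (thereₗ w∈rest)) linked (Adj-sym T x~w))

  -- A Unique path has at most n T vertices, so the fuel cannot run out.
  grow : ∀ fuel {x rest} → x ∈ R → Unique (x ∷ rest) → Linked (Adj T) (x ∷ rest) →
    n T < length (x ∷ rest) + fuel → ∃ λ ℓ → ℓ ∈ R × IsLeafOf T R ℓ
  grow zero _ unique _ bound =
    contradiction (Unique⇒length≤ unique) (<⇒≱ (subst (n T <_) (+-identityʳ _) bound))
  grow (suc fuel) {x} {rest} x∈R unique linked bound with twoNeighboursIn? x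
  ... | no  ¬two = x , x∈R , ¬TwoNeighboursIn⇒IsLeafOf ¬two
  ... | yes two  =
    let w , w∈R , x~w , w≢prev = next-neighbour two rest
        w∉path = no-chord unique linked x~w w≢prev
    in grow fuel w∈R (¬Any⇒All¬ _ w∉path ∷ unique) (Adj-sym T x~w ∷ linked)
            (subst (n T <_) (+-suc _ fuel) bound)

  leaf-exists : ∀ {r} → r ∈ R → ∃ λ ℓ → ℓ ∈ R × IsLeafOf T R ℓ
  leaf-exists r∈R = grow (n T) r∈R ([] ∷ []) [-] ≤-refl

-- Balanced 2-colourings

Balanced : ℕ → Subset N → Subset N → Set
Balanced m c B = ∣ B ∩ c ∣ ≤ m × ∣ B ∩ ∁ c ∣ ≤ m

Balanced-⊥ : ∀ {m} (c : Subset N) → Balanced m c ⊥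
Balanced-⊥ {N} c = empty c , empty (∁ c)
  where
  empty : ∀ {m} q → ∣ ⊥ ∩ q ∣ ≤ m
  empty q = ≤-trans (p⊆q⇒∣p∣≤∣q∣ (proj₁ ∘ x∈p∩q⁻ ⊥ q)) (≤-trans (≤-reflexive (∣⊥∣≡0 N)) z≤n)

Balanced-cong : ∀ {m} {c c′ B : Subset N} → B ∩ c′ ≡ B ∩ c → Balanced m c B → Balanced m c′ B
Balanced-cong {c = c} {c′} {B} eq (in-c , out-c) =
  subst (_≤ _) (sym (cong ∣_∣ eq)) in-c , subst (_≤ _) out-c≡ out-c
  where
  out-c≡ : ∣ B ∩ ∁ c ∣ ≡ ∣ B ∩ ∁ c′ ∣
  out-c≡ = +-cancelˡ-≡ ∣ B ∩ c ∣ _ _ (begin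
    ∣ B ∩ c ∣ + ∣ B ∩ ∁ c ∣     ≡⟨ ∣p∩q∣+∣p∩∁q∣≡∣p∣ B c ⟩
    ∣ B ∣                       ≡⟨ ∣p∩q∣+∣p∩∁q∣≡∣p∣ B c′ ⟨
    ∣ B ∩ c′ ∣ + ∣ B ∩ ∁ c′ ∣   ≡⟨ cong (λ s → ∣ s ∣ + ∣ B ∩ ∁ c′ ∣) eq ⟩
    ∣ B ∩ c ∣ + ∣ B ∩ ∁ c′ ∣    ∎)
    where open ≡-Reasoning

-- recolour X P c a puts the first a vertices of X outside P into c and the remaining ones out of it.
recolour : Subset N → Subset N → Subset N → ℕ → Subset N
recolour []            []            []      a       = []
recolour (inside  ∷ X) (outside ∷ P) (_ ∷ c) zero    = outside ∷ recolour X P c zero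
recolour (inside  ∷ X) (outside ∷ P) (_ ∷ c) (suc a) = inside  ∷ recolour X P c a
recolour (inside  ∷ X) (inside  ∷ P) (b ∷ c) a       = b ∷ recolour X P c a
recolour (outside ∷ X) (_       ∷ P) (b ∷ c) a       = b ∷ recolour X P c a

recolour-agrees : (Z X P c : Subset N) (a : ℕ) → Z ∩ X ⊆ P → Z ∩ recolour X P c a ≡ Z ∩ c
recolour-agrees []            []            []            []      a       _ = refl
recolour-agrees (inside  ∷ Z) (inside  ∷ X) (outside ∷ P) (_ ∷ c) a       Z∩X⊆P with Z∩X⊆P here
... | ()
recolour-agrees (outside ∷ Z) (inside  ∷ X) (outside ∷ P) (_ ∷ c) zero    Z∩X⊆P =
  cong (outside ∷_) (recolour-agrees Z X P c zero (drop-∷-⊆ Z∩X⊆P))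
recolour-agrees (outside ∷ Z) (inside  ∷ X) (outside ∷ P) (_ ∷ c) (suc a) Z∩X⊆P =
  cong (outside ∷_) (recolour-agrees Z X P c a (drop-∷-⊆ Z∩X⊆P))
recolour-agrees (z ∷ Z)       (inside  ∷ X) (inside  ∷ P) (b ∷ c) a       Z∩X⊆P =
  cong ((z ∧ b) ∷_) (recolour-agrees Z X P c a (drop-∷-⊆ Z∩X⊆P))
recolour-agrees (z ∷ Z)       (outside ∷ X) (_       ∷ P) (b ∷ c) a       Z∩X⊆P =
  cong ((z ∧ b) ∷_) (recolour-agrees Z X P c a (drop-∷-⊆ Z∩X⊆P))

∣X∩recolour∣≤ : (X P c : Subset N) (a : ℕ) → ∣ X ∩ recolour X P c a ∣ ≤ ∣ (X ∩ P) ∩ c ∣ + a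
∣X∩recolour∣≤ []            []            []            a       = z≤n
∣X∩recolour∣≤ (inside  ∷ X) (outside ∷ P) (_ ∷ c)       zero    = ∣X∩recolour∣≤ X P c zero
∣X∩recolour∣≤ (inside  ∷ X) (outside ∷ P) (_ ∷ c)       (suc a) =
  ≤-trans (s≤s (∣X∩recolour∣≤ X P c a)) (≤-reflexive (sym (+-suc _ a)))
∣X∩recolour∣≤ (inside  ∷ X) (inside  ∷ P) (inside  ∷ c) a       = s≤s (∣X∩recolour∣≤ X P c a)
∣X∩recolour∣≤ (inside  ∷ X) (inside  ∷ P) (outside ∷ c) a       = ∣X∩recolour∣≤ X P c a
∣X∩recolour∣≤ (outside ∷ X) (_       ∷ P) (_ ∷ c)       a       = ∣X∩recolour∣≤ X P c a

∣X∩∁recolour∣≤ : (X P c : Subset N) (a : ℕ) →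
  ∣ X ∩ ∁ (recolour X P c a) ∣ ≤ ∣ (X ∩ P) ∩ ∁ c ∣ + (∣ X ∩ ∁ P ∣ ∸ a)
∣X∩∁recolour∣≤ []            []            []            a       = z≤n
∣X∩∁recolour∣≤ (inside  ∷ X) (outside ∷ P) (_ ∷ c)       zero    =
  ≤-trans (s≤s (∣X∩∁recolour∣≤ X P c zero)) (≤-reflexive (sym (+-suc _ _)))
∣X∩∁recolour∣≤ (inside  ∷ X) (outside ∷ P) (_ ∷ c)       (suc a) = ∣X∩∁recolour∣≤ X P c a
∣X∩∁recolour∣≤ (inside  ∷ X) (inside  ∷ P) (inside  ∷ c) a       = ∣X∩∁recolour∣≤ X P c a
∣X∩∁recolour∣≤ (inside  ∷ X) (inside  ∷ P) (outside ∷ c) a       = s≤s (∣X∩∁recolour∣≤ X P c a)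
∣X∩∁recolour∣≤ (outside ∷ X) (_       ∷ P) (_ ∷ c)       a       = ∣X∩∁recolour∣≤ X P c a

remainder-fits : ∀ {m a b y} → a ≤ m → b ≤ m → a + b + y ≤ m + m → b + (y ∸ (m ∸ a)) ≤ m
remainder-fits {m} {a} {b} {y} a≤m b≤m total = begin
  b + (y ∸ (m ∸ a))  ≤⟨ +-monoʳ-≤ b (m≤n+o⇒m∸n≤o y (m ∸ a) y≤) ⟩
  b + (m ∸ b)        ≡⟨ m+[n∸m]≡n b≤m ⟩
  m                  ∎
  where
  open ≤-Reasoning
  y≤ : y ≤ (m ∸ a) + (m ∸ b)
  y≤ = +-cancelˡ-≤ (a + b) _ _ (begin
    a + b + y                        ≤⟨ total ⟩
    m + m                            ≡⟨ cong₂ _+_ (m+[n∸m]≡n a≤m) (m+[n∸m]≡n b≤m) ⟨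
    (a + (m ∸ a)) + (b + (m ∸ b))    ≡⟨ interchange a (m ∸ a) b (m ∸ b) ⟩
    (a + b) + ((m ∸ a) + (m ∸ b))    ∎)

-- the vertices of X lying in P keep their colour, and those are balanced since P is
recolour-balanced : ∀ {m} (X P c : Subset N) → ∣ X ∣ ≤ m + m → Balanced m c P →
  Balanced m (recolour X P c (m ∸ ∣ (X ∩ P) ∩ c ∣)) X
recolour-balanced {m = m} X P c X≤2m (in-c , out-c) =
  ≤-trans (∣X∩recolour∣≤ X P c (m ∸ a)) (≤-reflexive (m+[n∸m]≡n a≤m)) ,
  ≤-trans (∣X∩∁recolour∣≤ X P c (m ∸ a))
          (remainder-fits a≤m b≤m (≤-trans (≤-reflexive sizes) X≤2m))
  where
  a b : ℕ
  a = ∣ (X ∩ P) ∩ c ∣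
  b = ∣ (X ∩ P) ∩ ∁ c ∣
  X∩P∩q⊆P∩q : ∀ q → (X ∩ P) ∩ q ⊆ P ∩ q
  X∩P∩q⊆P∩q q x∈X∩P∩q =
    let x∈X∩P , x∈q = x∈p∩q⁻ (X ∩ P) q x∈X∩P∩q in x∈p∩q⁺ (proj₂ (x∈p∩q⁻ X P x∈X∩P) , x∈q)
  a≤m : a ≤ m
  a≤m = ≤-trans (p⊆q⇒∣p∣≤∣q∣ (X∩P∩q⊆P∩q c)) in-c
  b≤m : b ≤ m
  b≤m = ≤-trans (p⊆q⇒∣p∣≤∣q∣ (X∩P∩q⊆P∩q (∁ c))) out-c
  sizes : a + b + ∣ X ∩ ∁ P ∣ ≡ ∣ X ∣
  sizes = trans (cong (_+ ∣ X ∩ ∁ P ∣) (∣p∩q∣+∣p∩∁q∣≡∣p∣ (X ∩ P) c)) (∣p∩q∣+∣p∩∁q∣≡∣p∣ X P)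

module _ {G : Graph} (D : TreeDecomposition G) {m : ℕ} (small : ∀ t → ∣ bag D t ∣ ≤ m + m) where

  BalancedOn : Subset (n (T D)) → Subset (n G) → Set
  BalancedOn R c = ∀ {t} → t ∈ R → Balanced m c (bag D t)

  module _ {R : Subset (n (T D))} {ℓ : Vtx (T D)} (convex : Convex (T D) R) (ℓ∈R : ℓ ∈ R)
           (leaf : IsLeafOf (T D) R ℓ) where

    shared-with-neighbour : ∀ {s v} → s ∈ R - ℓ → v ∈ bag D s ∩ bag D ℓ →
      Σ (Vtx (T D)) λ q → q ∈ R - ℓ × Adj (T D) ℓ q × v ∈ bag D q
    shared-with-neighbour {s} s∈R′ v∈s∩ℓ =
      let v∈s , v∈ℓ = x∈p∩q⁻ _ _ v∈s∩ℓ
          q , q∈R , ℓ~q , v∈q = neighbour-on-walk (T D) convex ℓ∈R (p─q⊆p _ _ s∈R′)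
                                  (x∈p-y⇒x≢y s∈R′ ∘ sym) (subtree D _ ℓ s v∈ℓ v∈s)
      in q , x∈p∧x≢y⇒x∈p-y q∈R (Adj-irrefl (T D) ℓ~q ∘ sym) , ℓ~q , v∈q

    attachment : ∀ {c} → BalancedOn (R - ℓ) c →
      Σ (Subset (n G)) λ P → Balanced m c P × (∀ {s} → s ∈ R - ℓ → bag D s ∩ bag D ℓ ⊆ P)
    attachment {c} balanced with any? (λ p → p ∈? R - ℓ ×-dec adj (T D) ℓ p Bool.≟ true)
    ... | yes (p , p∈R′ , ℓ~p) = bag D p , balanced p∈R′ , in-bag-p
      where
      in-bag-p : ∀ {s} → s ∈ R - ℓ → bag D s ∩ bag D ℓ ⊆ bag D p
      in-bag-p s∈R′ v∈s∩ℓ =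
        let q , q∈R′ , ℓ~q , v∈q = shared-with-neighbour s∈R′ v∈s∩ℓ
        in subst (λ t → _ ∈ bag D t) (leaf (p─q⊆p _ _ q∈R′) (p─q⊆p _ _ p∈R′) ℓ~q ℓ~p) v∈q
    ... | no no-neighbour = ⊥ , Balanced-⊥ c , λ s∈R′ v∈s∩ℓ →
      let q , q∈R′ , ℓ~q , _ = shared-with-neighbour s∈R′ v∈s∩ℓ
      in contradiction (q , q∈R′ , ℓ~q) no-neighbour

    attach-leaf : ∀ {c} → BalancedOn (R - ℓ) c → ∃ (BalancedOn R)
    attach-leaf {c} balanced with attachment balanced
    ... | P , balanced-P , shared⊆P = c′ , balanced′
      where
      c′ : Subset (n G)
      c′ = recolour (bag D ℓ) P c (m ∸ ∣ (bag D ℓ ∩ P) ∩ c ∣)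
      balanced′ : BalancedOn R c′
      balanced′ {t} t∈R with t ≟ ℓ
      ... | yes refl = recolour-balanced (bag D ℓ) P c (small ℓ) balanced-P
      ... | no  t≢ℓ  =
        Balanced-cong (recolour-agrees (bag D t) (bag D ℓ) P c _ (shared⊆P t∈R′)) (balanced t∈R′)
        where
        t∈R′ : t ∈ R - ℓ
        t∈R′ = x∈p∧x≢y⇒x∈p-y t∈R t≢ℓ

  balanced-on : (R : Subset (n (T D))) → Acc _<_ ∣ R ∣ → Convex (T D) R → ∃ (BalancedOn R)
  balanced-on R (acc smaller) convex with nonempty? R
  ... | no  R-empty   = ⊥ , λ t∈R → contradiction (_ , t∈R) R-empty
  ... | yes (_ , r∈R) with leaf-exists (T D) (proj₂ (isTree D)) R r∈R
  ... | ℓ , ℓ∈R , leaf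
    with balanced-on (R - ℓ) (smaller (x∈p⇒∣p-x∣<∣p∣ ℓ∈R)) (Convex-remove-leaf (T D) leaf convex)
  ... | c , balanced = attach-leaf convex ℓ∈R leaf balanced

  balanced-colouring : ∃ λ c → ∀ t → Balanced m c (bag D t)
  balanced-colouring =
    let c , balanced = balanced-on ⊤ (<-wellFounded _) (⊤-convex (T D)) in c , λ t → balanced ∈⊤

inhabited? : ∀ N → Dec (Fin N)
inhabited? zero    = no λ ()
inhabited? (suc N) = yes zero

module _ {G : Graph} (no-vertex : ¬ Vtx G) where

  TwAtMost-empty : ∀ {k} → TreeDecomposition G → TwAtMost G k
  TwAtMost-empty {k} D = D , λ t → begin
    ∣ bag D t ∣  ≤⟨ p⊆q⇒∣p∣≤∣q∣ {p = bag D t} {q = ⊥} (λ {v} _ → contradiction v no-vertex) ⟩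
    ∣ ⊥ {n G} ∣  ≡⟨ ∣⊥∣≡0 (n G) ⟩
    0            ≤⟨ z≤n ⟩
    suc k        ∎
    where open ≤-Reasoning

  ⊆G-empty : (H : Graph) → G ⊆G H
  ⊆G-empty _ = (λ v → contradiction v no-vertex) , (λ {v} _ → contradiction v no-vertex) ,
               λ v _ _ → contradiction v no-vertex

n≤⌈n/2⌉+⌈n/2⌉ : ∀ n → n ≤ ⌈ n /2⌉ + ⌈ n /2⌉
n≤⌈n/2⌉+⌈n/2⌉ n = ≤-trans (≤-reflexive (sym (⌊n/2⌋+⌈n/2⌉≡n n))) (+-monoˡ-≤ ⌈ n /2⌉ (⌊n/2⌋≤⌈n/2⌉ n))

proposition18 : (k : ℕ) (G : Graph) → TwAtMost G k →
    Σ Graph λ H₁ → Σ Graph λ H₂ →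
      TwAtMost H₁ ⌈ suc k /2⌉ × TwAtMost H₂ ⌈ suc k /2⌉ × (G ⊆G (H₁ ⊠ H₂))
proposition18 k G (D , width) with inhabited? (n G)
... | no  no-vertex =
  G , G , TwAtMost-empty no-vertex D , TwAtMost-empty no-vertex D , ⊆G-empty {G} no-vertex (G ⊠ G)
... | yes v =
  cone (G [ S ]) , cone (G [ ∁ S ]) ,
  tw-cone-induced D t₀ S (proj₁ ∘ balanced) , tw-cone-induced D t₀ (∁ S) (proj₂ ∘ balanced) ,
  ⊆G-cone⊠cone G S
  where
  m = ⌈ suc k /2⌉
  t₀ : Vtx (T D)
  t₀ = proj₁ (covV D v)
  colouring : ∃ λ S → ∀ t → Balanced m S (bag D t)
  colouring = balanced-colouring D (λ t → ≤-trans (width t) (n≤⌈n/2⌉+⌈n/2⌉ (suc k)))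
  S : Subset (n G)
  S = proj₁ colouring
  balanced : ∀ t → Balanced m S (bag D t)
  balanced = proj₂ colouring
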